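{- Every line graph of a bipartite graph is a Helly-$B_1$-EPG graph.
   Context: All graphs are finite and simple. The line graph $L(H)$ of a graph $H$ has the edges of $H$ as vertices, two being adjacent iff they share an endpoint in $H$. An EPG representation of a graph $G$ assigns to each vertex $v$ a path $P_v$ in the (rectangular) grid such that two distinct vertices are adjacent in $G$ if and only if their paths share at least one grid edge. A $B_1$-EPG representation is an EPG representation in which every path has at most one bend. It is Helly if every subfamily of its paths that pairwise share a grid edge has a grid edge common to all paths of the subfamily. A graph is Helly-$B_1$-EPG if it admits a Helly $B_1$-EPG representation. -}

module Defs where

open import Data.Nat using (ℕ)
open import Data.Fin as Fin using (Fin)
open import Data.Bool using (Bool; T)
open import Data.Integer using (ℤ; _≤_; _<_; _⊓_; _⊔_)
open import Data.Product using (Σ; ∃; _×_; _,_)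
open import Data.Sum using (_⊎_)
open import Data.List using (List)
open import Data.List.Membership.Propositional using (_∈_)
open import Relation.Nullary using (¬_)
open import Relation.Binary.PropositionalEquality using (_≡_; _≢_)
open import Function using (_⇔_)

record SimpleGraph (n : ℕ) : Set where
  field
    adj    : Fin n → Fin n → Bool
    irrefl : ∀ v → ¬ T (adj v v)
    sym    : ∀ u v → T (adj u v) → T (adj v u)

open SimpleGraph public

Bipartite : ∀ {n} → SimpleGraph n → Set
Bipartite {n} H = Σ (Fin n → Bool) λ c → ∀ u v → T (adj H u v) → c u ≢ c v

Edge : ∀ {n} → SimpleGraph n → Set
Edge {n} H = Σ (Fin n × Fin n) λ { (u , v) → u Fin.< v × T (adj H u v) }

_isEndOf_ : ∀ {n} {H : SimpleGraph n} → Fin n → Edge H → Set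
x isEndOf ((u , v) , _) = x ≡ u ⊎ x ≡ v

LineAdj : ∀ {n} (H : SimpleGraph n) → Edge H → Edge H → Set
LineAdj {n} H e f = e ≢ f × Σ (Fin n) λ x → _isEndOf_ {H = H} x e × _isEndOf_ {H = H} x f

data Dir : Set where
  hor ver : Dir

-- (x , y , hor) is the grid edge {(x,y),(x+1,y)};
-- (x , y , ver) is the grid edge {(x,y),(x,y+1)}.
GridEdge : Set
GridEdge = ℤ × ℤ × Dir

-- A grid path with at most one bend: a horizontal segment from (hx,cy)
-- to the corner (cx,cy) followed by a vertical segment from (cx,cy)
-- to (cx,vy).  Either segment may be empty (0 bends), but the path has
-- at least one grid edge.
record B1Path : Set where
  field
    cx cy hx vy : ℤ
    nontrivial  : cx ≢ hx ⊎ cy ≢ vy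

_onPath_ : GridEdge → B1Path → Set
(x , y , hor) onPath p = y ≡ B1Path.cy p × (B1Path.cx p ⊓ B1Path.hx p) ≤ x × x < (B1Path.cx p ⊔ B1Path.hx p)
(x , y , ver) onPath p = x ≡ B1Path.cx p × (B1Path.cy p ⊓ B1Path.vy p) ≤ y × y < (B1Path.cy p ⊔ B1Path.vy p)

ShareEdge : B1Path → B1Path → Set
ShareEdge p q = Σ GridEdge λ e → e onPath p × e onPath q

record HellyB1EPGRep {V : Set} (Adj : V → V → Set) : Set where
  field
    path       : V → B1Path
    represents : ∀ u v → u ≢ v → (Adj u v ⇔ ShareEdge (path u) (path v))
    helly      : ∀ (S : List V) →
                 (∀ u v → u ∈ S → v ∈ S → u ≢ v → ShareEdge (path u) (path v)) →
                 Σ GridEdge λ e → ∀ u → u ∈ S → e onPath (path u)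

HellyB1EPG : {V : Set} → (V → V → Set) → Set
HellyB1EPG Adj = HellyB1EPGRep Adj

-- Colour H black and white, so that every edge e has a white end and a black
-- end.  Represent e by the L-shaped path with corner (black e , white e) whose
-- arms run to the coordinate axes: it covers the grid edges of row white e and
-- of column black e next to the axes, and two such paths share a grid edge
-- exactly when they lie on a common row or column, i.e. when the edges share an
-- end.  For the Helly property: if pairwise adjacent edges do not all have the
-- white end of e, some f has another white end and hence the black end of e;
-- every other edge differs in its white end from e or from f, so it also has
-- that black end.
module Submission where

open import Defs hiding (sym)
open import Data.Nat using (ℕ; suc; z≤n; s≤s)
open import Data.Nat.Properties using (suc-injective)
open import Data.Fin using (Fin; toℕ)
open import Data.Fin.Properties using (toℕ-injective) renaming (_≟_ to _≟ᶠ_)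
open import Data.Bool using (true; false; not; if_then_else_)
open import Data.Bool.Properties using (¬-not)
open import Data.Integer using (+_; +≤+; +<+)
open import Data.Integer.Properties using (+-injective)
open import Data.Product using (Σ; _,_)
open import Data.Sum using (_⊎_; inj₁; inj₂; swap; map)
open import Data.List using (List; []; _∷_)
open import Data.List.Membership.Propositional using (_∈_; find)
open import Data.List.Relation.Unary.All as All using (All; all?)
open import Data.List.Relation.Unary.All.Properties using (¬All⇒Any¬)
open import Data.List.Relation.Unary.Any using (here)
open import Relation.Binary.Definitions using (DecidableEquality)
open import Relation.Nullary using (yes; no; contradiction)
open import Relation.Binary.PropositionalEquality using (_≡_; _≢_; refl; sym; trans; cong)
open import Function using (_⇔_; mk⇔; Equivalence; _∘_)

SameEnd : {E X : Set} (α β : E → X) → E → E → Set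
SameEnd α β e f = α e ≡ α f ⊎ β e ≡ β f

module _ {E X : Set} (_≟_ : DecidableEquality X) (α β : E → X) where

  PairwiseSameEnd : List E → Set
  PairwiseSameEnd S = ∀ u v → u ∈ S → v ∈ S → u ≢ v → SameEnd α β u v

  module _ {e S} (same : PairwiseSameEnd (e ∷ S)) where

    distinctα⇒sameβ : ∀ {u v} → u ∈ e ∷ S → v ∈ e ∷ S → α u ≢ α v → β u ≡ β v
    distinctα⇒sameβ {u} {v} u∈ v∈ αu≢αv with same u v u∈ v∈ (αu≢αv ∘ cong α)
    ... | inj₁ αu≡αv = contradiction αu≡αv αu≢αv
    ... | inj₂ βu≡βv = βu≡βv

    outsider⇒allSameβ : ∀ {f} → f ∈ e ∷ S → α f ≢ α e → All (λ g → β g ≡ β e) (e ∷ S)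
    outsider⇒allSameβ {f} f∈ αf≢αe = All.tabulate sameβ
      where
      sameβ : ∀ {g} → g ∈ e ∷ S → β g ≡ β e
      sameβ {g} g∈ with α g ≟ α e
      ... | no αg≢αe = distinctα⇒sameβ g∈ (here refl) αg≢αe
      ... | yes αg≡αe =
        trans (distinctα⇒sameβ g∈ f∈ (λ αg≡αf → αf≢αe (trans (sym αg≡αf) αg≡αe)))
              (distinctα⇒sameβ f∈ (here refl) αf≢αe)

  pairwiseSameEnd⇒star : ∀ e S → PairwiseSameEnd (e ∷ S) →
    All (λ f → α f ≡ α e) (e ∷ S) ⊎ All (λ f → β f ≡ β e) (e ∷ S)
  pairwiseSameEnd⇒star e S same with all? (λ f → α f ≟ α e) (e ∷ S)
  ... | yes allα = inj₁ allα
  ... | no ¬allα with find (¬All⇒Any¬ (λ f → α f ≟ α e) (e ∷ S) ¬allα)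
  ...   | _ , f∈ , αf≢αe = inj₂ (outsider⇒allSameβ same f∈ αf≢αe)

rowEdge columnEdge : ℕ → GridEdge
rowEdge j = + 0 , + suc j , hor
columnEdge i = + suc i , + 0 , ver

-- Corner at (suc i , suc j), arms running to the axes; the shift by one keeps both arms nonempty.
lPath : ℕ → ℕ → B1Path
lPath i j = record { cx = + suc i ; cy = + suc j ; hx = + 0 ; vy = + 0 ; nontrivial = inj₁ λ () }

lPath-row : ∀ {i j k} → j ≡ k → rowEdge k onPath lPath i j
lPath-row refl = refl , +≤+ z≤n , +<+ (s≤s z≤n)

lPath-column : ∀ {i j k} → i ≡ k → columnEdge k onPath lPath i j
lPath-column refl = refl , +≤+ z≤n , +<+ (s≤s z≤n)

lPath-share : ∀ {i j i′ j′} → ShareEdge (lPath i j) (lPath i′ j′) → j ≡ j′ ⊎ i ≡ i′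
lPath-share ((_ , _ , hor) , (y≡ , _) , (y≡′ , _)) = inj₁ (suc-injective (+-injective (trans (sym y≡) y≡′)))
lPath-share ((_ , _ , ver) , (x≡ , _) , (x≡′ , _)) = inj₂ (suc-injective (+-injective (trans (sym x≡) x≡′)))

module _ {n} (H : SimpleGraph n) (bipartite : Bipartite H) where

  open Σ bipartite renaming (proj₁ to colour; proj₂ to proper)

  white black : Edge H → Fin n
  white ((u , v) , _) = if colour u then u else v
  black ((u , v) , _) = if colour u then v else u

  white-isWhite : ∀ e → colour (white e) ≡ true
  white-isWhite ((u , v) , _ , uv) with colour u in cu
  ... | true = cu
  ... | false = trans (¬-not (proper u v uv ∘ sym)) (cong not cu)

  black-isBlack : ∀ e → colour (black e) ≡ false
  black-isBlack ((u , v) , _ , uv) with colour u in cu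
  ... | true = trans (¬-not (proper u v uv ∘ sym)) (cong not cu)
  ... | false = cu

  white≢black : ∀ e f → white e ≢ black f
  white≢black e f we≡bf with trans (sym (white-isWhite e)) (trans (cong colour we≡bf) (black-isBlack f))
  ... | ()

  isEndOf⇔white⊎black : ∀ x e → _isEndOf_ {H = H} x e ⇔ (x ≡ white e ⊎ x ≡ black e)
  isEndOf⇔white⊎black x ((u , v) , _) with colour u
  ... | true = mk⇔ (λ p → p) (λ p → p)
  ... | false = mk⇔ swap swap

  commonEnd⇒sameEnd : ∀ {x} e f → _isEndOf_ {H = H} x e → _isEndOf_ {H = H} x f → SameEnd white black e f
  commonEnd⇒sameEnd {x} e f xe xf
    with Equivalence.to (isEndOf⇔white⊎black x e) xe | Equivalence.to (isEndOf⇔white⊎black x f) xf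
  ... | inj₁ x≡we | inj₁ x≡wf = inj₁ (trans (sym x≡we) x≡wf)
  ... | inj₂ x≡be | inj₂ x≡bf = inj₂ (trans (sym x≡be) x≡bf)
  ... | inj₁ x≡we | inj₂ x≡bf = contradiction (trans (sym x≡we) x≡bf) (white≢black e f)
  ... | inj₂ x≡be | inj₁ x≡wf = contradiction (trans (sym x≡wf) x≡be) (white≢black f e)

  sameEnd⇒lineAdj : ∀ e f → e ≢ f → SameEnd white black e f → LineAdj H e f
  sameEnd⇒lineAdj e f e≢f (inj₁ we≡wf) = e≢f , white e , Equivalence.from (isEndOf⇔white⊎black _ e) (inj₁ refl)
                                                      , Equivalence.from (isEndOf⇔white⊎black _ f) (inj₁ we≡wf)
  sameEnd⇒lineAdj e f e≢f (inj₂ be≡bf) = e≢f , black e , Equivalence.from (isEndOf⇔white⊎black _ e) (inj₂ refl)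
                                                      , Equivalence.from (isEndOf⇔white⊎black _ f) (inj₂ be≡bf)

  path : Edge H → B1Path
  path e = lPath (toℕ (black e)) (toℕ (white e))

  shareEdge⇔sameEnd : ∀ e f → ShareEdge (path e) (path f) ⇔ SameEnd white black e f
  shareEdge⇔sameEnd e f = mk⇔ (map toℕ-injective toℕ-injective ∘ lPath-share) share
    where
    share : SameEnd white black e f → ShareEdge (path e) (path f)
    share (inj₁ we≡wf) = rowEdge (toℕ (white e)) , lPath-row refl , lPath-row (cong toℕ (sym we≡wf))
    share (inj₂ be≡bf) = columnEdge (toℕ (black e)) , lPath-column refl , lPath-column (cong toℕ (sym be≡bf))

  lineAdj⇔shareEdge : ∀ e f → e ≢ f → LineAdj H e f ⇔ ShareEdge (path e) (path f)
  lineAdj⇔shareEdge e f e≢f = mk⇔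
    (λ (_ , _ , xe , xf) → Equivalence.from (shareEdge⇔sameEnd e f) (commonEnd⇒sameEnd e f xe xf))
    (sameEnd⇒lineAdj e f e≢f ∘ Equivalence.to (shareEdge⇔sameEnd e f))

  helly : ∀ S → (∀ u v → u ∈ S → v ∈ S → u ≢ v → ShareEdge (path u) (path v)) →
          Σ GridEdge λ g → ∀ u → u ∈ S → g onPath path u
  helly [] _ = (+ 0 , + 0 , hor) , λ _ ()
  helly (e ∷ S) share with pairwiseSameEnd⇒star _≟ᶠ_ white black e S
                             (λ u v u∈ v∈ u≢v → Equivalence.to (shareEdge⇔sameEnd u v) (share u v u∈ v∈ u≢v))
  ... | inj₁ whites = rowEdge (toℕ (white e)) , λ u u∈ → lPath-row (cong toℕ (All.lookup whites u∈))
  ... | inj₂ blacks = columnEdge (toℕ (black e)) , λ u u∈ → lPath-column (cong toℕ (All.lookup blacks u∈))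

corollary4 : ∀ {n} (H : SimpleGraph n) → Bipartite H → HellyB1EPG (LineAdj H)
corollary4 H B = record
  { path = path H B
  ; represents = lineAdj⇔shareEdge H B
  ; helly = helly H B
  }
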